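{- For every $k\geq 1$ and $n=t_k=\frac{k(k+1)}{2}$, we have ${\rm I}_e(K_n)=|E(K_n)|-\frac{k(k+1)(k-1)(3k+2)}{24}$, where $K_n$ is the complete graph of order $n$.
   Context: All graphs are finite and simple. A graph is locally irregular if no two adjacent vertices have the same degree. For a graph $G=(V,E)$, a set $S\subseteq E$ is an edge-irregulator of $G$ if $G-S$ is locally irregular, and ${\rm I}_e(G)$ is the minimum cardinality of an edge-irregulator of $G$. $t_k$ denotes the $k$-th triangular number $1+2+\dots+k$. -}

module Defs where

open import Data.Nat using (ℕ; zero; suc; _+_; _≤_; _<_)
open import Data.Bool using (Bool; true; false; _∧_; not; _∨_)
open import Data.Fin using (Fin; toℕ)
open import Data.Fin.Properties using (_≟_)
open import Data.List using (List; length; filter; allFin)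
open import Data.Bool.ListAction using (any)
open import Data.List.Relation.Unary.All using (All)
open import Data.List.Relation.Unary.Unique.Propositional using (Unique)
open import Data.Product using (_×_; _,_; proj₁; proj₂; ∃)
open import Relation.Binary.PropositionalEquality using (_≡_; _≢_)
open import Relation.Nullary.Decidable using (⌊_⌋)

record Graph (n : ℕ) : Set where
  field
    adj     : Fin n → Fin n → Bool
    symm    : ∀ u v → adj u v ≡ adj v u
    irrefl  : ∀ v → adj v v ≡ false
open Graph public

-- An edge {u,v} is represented by the ordered pair (u , v) with u < v.
Edge : ℕ → Set
Edge n = Fin n × Fin n

IsEdge : ∀ {n} → Graph n → Edge n → Set
IsEdge G (u , v) = (toℕ u < toℕ v) × (adj G u v ≡ true)

_∈ᵇ_ : ∀ {n} → Fin n × Fin n → List (Edge n) → Bool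
(u , v) ∈ᵇ S = any (λ e → (⌊ proj₁ e ≟ u ⌋ ∧ ⌊ proj₂ e ≟ v ⌋) ∨ (⌊ proj₁ e ≟ v ⌋ ∧ ⌊ proj₂ e ≟ u ⌋)) S

adjMinus : ∀ {n} → Graph n → List (Edge n) → Fin n → Fin n → Bool
adjMinus G S u v = adj G u v ∧ not ((u , v) ∈ᵇ S)

degree : ∀ {n} → (Fin n → Fin n → Bool) → Fin n → ℕ
degree {n} a v = length (filter (λ u → a v u ≡? true) (allFin n))
  where
  open import Data.Bool.Properties using () renaming (_≟_ to _≡?_)

LocallyIrregular : ∀ {n} → (Fin n → Fin n → Bool) → Set
LocallyIrregular {n} a = ∀ (u v : Fin n) → a u v ≡ true → degree a u ≢ degree a v

IsEdgeIrregulator : ∀ {n} → Graph n → List (Edge n) → Set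
IsEdgeIrregulator G S = All (IsEdge G) S × Unique S × LocallyIrregular (adjMinus G S)

IeIs : ∀ {n} → Graph n → ℕ → Set
IeIs G m = (∃ λ S → IsEdgeIrregulator G S × length S ≡ m)
         × (∀ S → IsEdgeIrregulator G S → m ≤ length S)

complete : (n : ℕ) → Graph n
complete n = record
  { adj = λ u v → not ⌊ u ≟ v ⌋
  ; symm = λ u v → symmProof u v
  ; irrefl = λ v → irr v }
  where
  open import Relation.Nullary using (yes; no)
  open import Relation.Binary.PropositionalEquality using (refl; sym)
  symmProof : ∀ (u v : Fin n) → not ⌊ u ≟ v ⌋ ≡ not ⌊ v ≟ u ⌋
  symmProof u v with u ≟ v | v ≟ u
  ... | yes _ | yes _ = refl
  ... | no _  | no _  = refl
  ... | yes p | no q  = Data.Empty.⊥-elim (q (sym p))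
    where import Data.Empty
  ... | no p  | yes q = Data.Empty.⊥-elim (p (sym q))
    where import Data.Empty
  irr : ∀ (v : Fin n) → not ⌊ v ≟ v ⌋ ≡ false
  irr v with v ≟ v
  ... | yes _ = refl
  ... | no p = Data.Empty.⊥-elim (p refl)
    where import Data.Empty

numEdges : ∀ {n} → Graph n → ℕ
numEdges {n} G = length (filter (λ e → toℕ (proj₁ e) <? toℕ (proj₂ e))
                   (filter (λ e → adj G (proj₁ e) (proj₂ e) ≡? true) (allPairs n)))
  where
  open import Data.Bool.Properties using () renaming (_≟_ to _≡?_)
  open import Data.Nat.Properties using (_<?_)
  open import Data.List using (cartesianProduct)
  allPairs : ∀ m → List (Fin m × Fin m)
  allPairs m = cartesianProduct (allFin m) (allFin m)

t : ℕ → ℕ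
t zero = 0
t (suc k) = suc k + t k

module Submission where

-- In K_n − S put c(v) = n − deg(v), the number of non-neighbours of v counting v itself. If
-- K_n − S is locally irregular, the vertices sharing the value c(v) are pairwise non-adjacent, so
-- they all lie among those c(v) non-neighbours of v: every value j is taken at most j times. For
-- n = t_k this forces Σ c(v) ≥ 1² + ⋯ + k², i.e. Σ deg(v) ≤ n² − (1² + ⋯ + k²), and the
-- handshake lemma turns this into a lower bound on |S|. The bound is attained by cutting the
-- vertex set into blocks of sizes 1, …, k and deleting the edges inside the blocks: a vertex in a
-- block of size j keeps degree n − j. What remains is the complete multipartite graph with parts
-- of sizes 1, …, k, which has k(k+1)(k−1)(3k+2)/24 edges.

open import Defs
open import Data.Nat using (ℕ; _≥_; _*_; _+_; _∸_; _/_)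
open import Data.Nat using (_≤_)
open import Data.Nat using (zero; suc; _<_; z≤n; s≤s⁻¹)

open import Data.Bool using (Bool; true; false; _∧_; _∨_; not)
import Data.Bool.Properties as Bool
open import Data.Fin using (Fin; zero; suc; toℕ; splitAt; _↑ˡ_; _↑ʳ_)
import Data.Fin.Properties as Fin
open import Data.Fin.Properties using (_≟_; any?; splitAt-↑ˡ; splitAt-↑ʳ; toℕ-injective)
open import Data.List using (List; []; _∷_; length; filter; allFin; tabulate; cartesianProduct)
open import Data.List.Membership.Propositional using (_∈_)
open import Data.List.Membership.Propositional.Properties using (∈-filter⁺; ∈-filter⁻; ∈-cartesianProduct⁺; ∈-allFin)
open import Data.List.Properties using (length-filter; length-tabulate)
open import Data.List.Relation.Unary.All as All using (All; _∷_)
open import Data.List.Relation.Unary.AllPairs using (_∷_)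
import Data.List.Relation.Unary.Any as Any
open import Data.List.Relation.Unary.Any.Properties using (any⁺; any⁻; Any-⊎⁺; Any-⊎⁻)
open import Data.List.Relation.Unary.Unique.Propositional using (Unique)
open import Data.List.Relation.Unary.Unique.Propositional.Properties using (filter⁺; cartesianProduct⁺; allFin⁺)
open import Data.Nat.DivMod using (m*n/n≡m)
open import Data.Nat.Properties renaming (_≟_ to _≟ℕ_)
open import Data.Nat.Tactic.RingSolver using (solve-∀)
open import Data.Product using (_,_; proj₁; proj₂)
open import Data.Sum as Sum using (_⊎_; inj₁; inj₂; [_,_]′)
open import Function using (_∘_; id; const; _⇔_; mk⇔; Equivalence)
open Equivalence using (to; from)
open import Relation.Binary.Definitions using (tri<; tri≈; tri>)
open import Relation.Binary.PropositionalEquality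
open import Relation.Nullary using (yes; no; ¬_; contradiction)
open import Relation.Nullary.Decidable using (Dec; ⌊_⌋; dec-true; dec-false; isYes≗does; ⌊⌋-map′)
open import Algebra.Properties.Semiring.Sum +-*-semiring using (sum; sum-syntax; sum-cong-≗; ∑-distrib-+; *-distribˡ-sum)

𝟙 : Bool → ℕ
𝟙 true  = 1
𝟙 false = 0

𝟙≤1 : ∀ b → 𝟙 b ≤ 1
𝟙≤1 true  = ≤-refl
𝟙≤1 false = z≤n

𝟙-∧ : ∀ a b → 𝟙 (a ∧ b) ≡ 𝟙 a * 𝟙 b
𝟙-∧ true  b = sym (+-identityʳ (𝟙 b))
𝟙-∧ false b = refl

𝟙-∨ : ∀ a b → (a ≡ true → b ≢ true) → 𝟙 (a ∨ b) ≡ 𝟙 a + 𝟙 b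
𝟙-∨ true  true  excl = contradiction refl (excl refl)
𝟙-∨ true  false _    = refl
𝟙-∨ false b     _    = refl

𝟙-not : ∀ b → 𝟙 (not b) + 𝟙 b ≡ 1
𝟙-not true  = refl
𝟙-not false = refl

𝟙-∧-not : ∀ a b → (b ≡ true → a ≡ true) → 𝟙 (a ∧ not b) + 𝟙 b ≡ 𝟙 a
𝟙-∧-not a     false _   = trans (+-identityʳ (𝟙 (a ∧ true))) (cong 𝟙 (Bool.∧-identityʳ a))
𝟙-∧-not true  true  _   = refl
𝟙-∧-not false true  b⇒a = contradiction (b⇒a refl) λ ()

∑-const : ∀ n c → ∑[ i < n ] c ≡ n * c
∑-const zero    c = refl
∑-const (suc n) c = cong (c +_) (∑-const n c)

∑-mono-≤ : ∀ {n} {f g : Fin n → ℕ} → (∀ i → f i ≤ g i) → sum f ≤ sum g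
∑-mono-≤ {zero}  f≤g = z≤n
∑-mono-≤ {suc n} f≤g = +-mono-≤ (f≤g zero) (∑-mono-≤ (f≤g ∘ suc))

∑-zero : ∀ {n} {f : Fin n → ℕ} → (∀ i → f i ≡ 0) → sum f ≡ 0
∑-zero {n} f≡0 = trans (sum-cong-≗ f≡0) (trans (∑-const n 0) (*-zeroʳ n))

∑-↑ : ∀ m {n} (f : Fin (m + n) → ℕ) → sum f ≡ ∑[ i < m ] f (i ↑ˡ n) + ∑[ j < n ] f (m ↑ʳ j)
∑-↑ zero    f = refl
∑-↑ (suc m) f = trans (cong (f zero +_) (∑-↑ m (f ∘ suc))) (sym (+-assoc (f zero) _ _))

-- ⌊_⌋ is isYes, which (unlike does) does not compute through map′; dec-true is stated for does.
⌊⌋-yes : ∀ {a} {A : Set a} (d : Dec A) → A → ⌊ d ⌋ ≡ true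
⌊⌋-yes d x = trans (isYes≗does d) (dec-true d x)

⌊⌋-no : ∀ {a} {A : Set a} (d : Dec A) → ¬ A → ⌊ d ⌋ ≡ false
⌊⌋-no d ¬x = trans (isYes≗does d) (dec-false d ¬x)

count : ∀ {n} → (Fin n → Bool) → ℕ
count {n} p = ∑[ i < n ] 𝟙 (p i)

count-none : ∀ {n} {p : Fin n → Bool} → (∀ i → p i ≡ false) → count p ≡ 0
count-none none = ∑-zero (cong 𝟙 ∘ none)

count-not : ∀ {n} (p : Fin n → Bool) → count (not ∘ p) + count p ≡ n
count-not {n} p = begin
  count (not ∘ p) + count p             ≡⟨ ∑-distrib-+ (𝟙 ∘ not ∘ p) (𝟙 ∘ p) ⟨
  ∑[ i < n ] (𝟙 (not (p i)) + 𝟙 (p i))  ≡⟨ sum-cong-≗ (𝟙-not ∘ p) ⟩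
  ∑[ i < n ] 1                          ≡⟨ ∑-const n 1 ⟩
  n * 1                                 ≡⟨ *-identityʳ n ⟩
  n                                     ∎
  where open ≡-Reasoning

count-≟ : ∀ {n} (a : Fin n) → count (λ u → ⌊ a ≟ u ⌋) ≡ 1
count-≟ {suc n} zero    = cong suc (count-none {n} (λ _ → refl))
count-≟ {suc n} (suc a) = trans (sum-cong-≗ (λ u → cong 𝟙 (⌊⌋-map′ (cong suc) Fin.suc-injective (a ≟ u)))) (count-≟ a)

length-filter-tabulate : ∀ {a} {A : Set a} {m} (g : Fin m → A) (p : A → Bool) →
  length (filter (λ x → p x Bool.≟ true) (tabulate g)) ≡ count (p ∘ g)
length-filter-tabulate {m = zero}  g p = refl
length-filter-tabulate {m = suc m} g p with p (g zero)
... | true  = cong suc (length-filter-tabulate (g ∘ suc) p)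
... | false = length-filter-tabulate (g ∘ suc) p

degree≡count : ∀ {n} (a : Fin n → Fin n → Bool) v → degree a v ≡ count (a v)
degree≡count a v = length-filter-tabulate id (a v)

degree≤ : ∀ {n} (a : Fin n → Fin n → Bool) v → degree a v ≤ n
degree≤ {n} a v = ≤-trans (length-filter (λ u → a v u Bool.≟ true) (allFin n)) (≤-reflexive (length-tabulate id))

-- (v , u) ∈ᵇ S unfolds to any (λ e → matches e v u) S.
matches : ∀ {n} → Edge n → Fin n → Fin n → Bool
matches (a , b) v u = (⌊ a ≟ v ⌋ ∧ ⌊ b ≟ u ⌋) ∨ (⌊ a ≟ u ⌋ ∧ ⌊ b ≟ v ⌋)

both-≟⁻ : ∀ {n} {a b x y : Fin n} → ⌊ a ≟ x ⌋ ∧ ⌊ b ≟ y ⌋ ≡ true → (x , y) ≡ (a , b)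
both-≟⁻ {a = a} {b} {x} {y} h with a ≟ x | b ≟ y
both-≟⁻ h  | yes refl | yes refl = refl
both-≟⁻ () | no _     | _
both-≟⁻ () | yes _    | no _

matches⁻ : ∀ {n} {e : Edge n} {v u} → matches e v u ≡ true → (v , u) ≡ e ⊎ (u , v) ≡ e
matches⁻ {e = a , b} {v} {u} h with ⌊ a ≟ v ⌋ ∧ ⌊ b ≟ u ⌋ in eq
... | true  = inj₁ (both-≟⁻ eq)
... | false = inj₂ (both-≟⁻ h)

matches⁺ : ∀ {n} {e : Edge n} {v u} → (v , u) ≡ e ⊎ (u , v) ≡ e → matches e v u ≡ true
matches⁺ {e = a , b} (inj₁ refl) rewrite ⌊⌋-yes (a ≟ a) refl | ⌊⌋-yes (b ≟ b) refl = refl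
matches⁺ {e = a , b} (inj₂ refl) rewrite ⌊⌋-yes (a ≟ a) refl | ⌊⌋-yes (b ≟ b) refl = Bool.∨-zeroʳ _

∈ᵇ⇔ : ∀ {n} {S : List (Edge n)} {v u} → (v , u) ∈ᵇ S ≡ true ⇔ ((v , u) ∈ S ⊎ (u , v) ∈ S)
∈ᵇ⇔ {S = S} = mk⇔
  (Any-⊎⁻ ∘ Any.map (matches⁻ ∘ to Bool.T-≡) ∘ any⁻ _ S ∘ from Bool.T-≡)
  (to Bool.T-≡ ∘ any⁺ _ ∘ Any.map (from Bool.T-≡ ∘ matches⁺) ∘ Any-⊎⁺)

count-matches : ∀ {n} {a b : Fin n} → a ≢ b → ∀ v → count (matches (a , b) v) ≡ 𝟙 ⌊ a ≟ v ⌋ + 𝟙 ⌊ b ≟ v ⌋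
count-matches {n} {a} {b} a≢b v = begin
  count (matches (a , b) v)
    ≡⟨ sum-cong-≗ split ⟩
  ∑[ u < n ] (𝟙 ⌊ a ≟ v ⌋ * 𝟙 ⌊ b ≟ u ⌋ + 𝟙 ⌊ b ≟ v ⌋ * 𝟙 ⌊ a ≟ u ⌋)
    ≡⟨ ∑-distrib-+ (λ u → 𝟙 ⌊ a ≟ v ⌋ * 𝟙 ⌊ b ≟ u ⌋) (λ u → 𝟙 ⌊ b ≟ v ⌋ * 𝟙 ⌊ a ≟ u ⌋) ⟩
  ∑[ u < n ] (𝟙 ⌊ a ≟ v ⌋ * 𝟙 ⌊ b ≟ u ⌋) + ∑[ u < n ] (𝟙 ⌊ b ≟ v ⌋ * 𝟙 ⌊ a ≟ u ⌋)
    ≡⟨ cong₂ _+_ (*-distribˡ-sum (𝟙 ⌊ a ≟ v ⌋) (λ u → 𝟙 ⌊ b ≟ u ⌋))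
                 (*-distribˡ-sum (𝟙 ⌊ b ≟ v ⌋) (λ u → 𝟙 ⌊ a ≟ u ⌋)) ⟨
  𝟙 ⌊ a ≟ v ⌋ * count (λ u → ⌊ b ≟ u ⌋) + 𝟙 ⌊ b ≟ v ⌋ * count (λ u → ⌊ a ≟ u ⌋)
    ≡⟨ cong₂ _+_ (trans (cong (𝟙 ⌊ a ≟ v ⌋ *_) (count-≟ b)) (*-identityʳ (𝟙 ⌊ a ≟ v ⌋)))
                 (trans (cong (𝟙 ⌊ b ≟ v ⌋ *_) (count-≟ a)) (*-identityʳ (𝟙 ⌊ b ≟ v ⌋))) ⟩
  𝟙 ⌊ a ≟ v ⌋ + 𝟙 ⌊ b ≟ v ⌋
    ∎
  where
  open ≡-Reasoning
  split : ∀ u → 𝟙 (matches (a , b) v u) ≡ 𝟙 ⌊ a ≟ v ⌋ * 𝟙 ⌊ b ≟ u ⌋ + 𝟙 ⌊ b ≟ v ⌋ * 𝟙 ⌊ a ≟ u ⌋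
  split u = begin
    𝟙 (matches (a , b) v u)
      ≡⟨ 𝟙-∨ (⌊ a ≟ v ⌋ ∧ ⌊ b ≟ u ⌋) (⌊ a ≟ u ⌋ ∧ ⌊ b ≟ v ⌋) (λ h h′ →
           a≢b (trans (sym (cong proj₁ (both-≟⁻ h))) (cong proj₂ (both-≟⁻ h′)))) ⟩
    𝟙 (⌊ a ≟ v ⌋ ∧ ⌊ b ≟ u ⌋) + 𝟙 (⌊ a ≟ u ⌋ ∧ ⌊ b ≟ v ⌋)
      ≡⟨ cong₂ _+_ (𝟙-∧ ⌊ a ≟ v ⌋ _) (trans (𝟙-∧ ⌊ a ≟ u ⌋ _) (*-comm (𝟙 ⌊ a ≟ u ⌋) _)) ⟩
    𝟙 ⌊ a ≟ v ⌋ * 𝟙 ⌊ b ≟ u ⌋ + 𝟙 ⌊ b ≟ v ⌋ * 𝟙 ⌊ a ≟ u ⌋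
      ∎

∑-count-∈ᵇ : ∀ {n} (S : List (Edge n)) → All (λ e → toℕ (proj₁ e) < toℕ (proj₂ e)) S → Unique S →
  ∑[ v < n ] count (λ u → (v , u) ∈ᵇ S) ≡ 2 * length S
∑-count-∈ᵇ {n} []            _               _               = ∑-zero {n} λ _ → count-none {n} λ _ → refl
∑-count-∈ᵇ {n} ((a , b) ∷ S) (a<b ∷ ordered) (ab∉S ∷ unique) = begin
  ∑[ v < n ] count (λ u → matches (a , b) v u ∨ (v , u) ∈ᵇ S)
    ≡⟨ sum-cong-≗ (λ v → trans (sum-cong-≗ (λ u → 𝟙-∨ _ _ (disjoint v u)))
                                  (∑-distrib-+ (𝟙 ∘ matches (a , b) v) (λ u → 𝟙 ((v , u) ∈ᵇ S)))) ⟩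
  ∑[ v < n ] (count (matches (a , b) v) + count (λ u → (v , u) ∈ᵇ S))
    ≡⟨ ∑-distrib-+ (count ∘ matches (a , b)) (λ v → count (λ u → (v , u) ∈ᵇ S)) ⟩
  ∑[ v < n ] count (matches (a , b) v) + ∑[ v < n ] count (λ u → (v , u) ∈ᵇ S)
    ≡⟨ cong₂ _+_ ∑-count-matches (∑-count-∈ᵇ S ordered unique) ⟩
  2 + 2 * length S
    ≡⟨ *-suc 2 (length S) ⟨
  2 * suc (length S)
    ∎
  where
  open ≡-Reasoning
  a≢b : a ≢ b
  a≢b a≡b = <-irrefl (cong toℕ a≡b) a<b
  ∑-count-matches : ∑[ v < n ] count (matches (a , b) v) ≡ 2
  ∑-count-matches = trans (sum-cong-≗ (count-matches a≢b))
    (trans (∑-distrib-+ (λ v → 𝟙 ⌊ a ≟ v ⌋) (λ v → 𝟙 ⌊ b ≟ v ⌋)) (cong₂ _+_ (count-≟ a) (count-≟ b)))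
  disjoint : ∀ v u → matches (a , b) v u ≡ true → (v , u) ∈ᵇ S ≢ true
  disjoint v u m m′ with matches⁻ {e = a , b} {v} {u} m | to (∈ᵇ⇔ {S = S}) m′
  ... | inj₁ refl | inj₁ p = All.lookup ab∉S p refl
  ... | inj₁ refl | inj₂ p = <-asym a<b (All.lookup ordered p)
  ... | inj₂ refl | inj₁ p = <-asym a<b (All.lookup ordered p)
  ... | inj₂ refl | inj₂ p = All.lookup ab∉S p refl

∈ᵇ⇒adj : ∀ {n} (G : Graph n) {S} → All (IsEdge G) S → ∀ {v u} → (v , u) ∈ᵇ S ≡ true → adj G v u ≡ true
∈ᵇ⇒adj G S⊆E {v} {u} v-u∈S with to ∈ᵇ⇔ v-u∈S
... | inj₁ vu∈S = proj₂ (All.lookup S⊆E vu∈S)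
... | inj₂ uv∈S = trans (symm G v u) (proj₂ (All.lookup S⊆E uv∈S))

∑-degree-adjMinus : ∀ {n} (G : Graph n) (S : List (Edge n)) → All (IsEdge G) S → Unique S →
  ∑[ v < n ] degree (adjMinus G S) v + 2 * length S ≡ ∑[ v < n ] degree (adj G) v
∑-degree-adjMinus {n} G S S⊆E unique = begin
  ∑[ v < n ] degree (adjMinus G S) v + 2 * length S
    ≡⟨ cong₂ _+_ (sum-cong-≗ (degree≡count (adjMinus G S))) (sym (∑-count-∈ᵇ S (All.map proj₁ S⊆E) unique)) ⟩
  ∑[ v < n ] count (adjMinus G S v) + ∑[ v < n ] count (λ u → (v , u) ∈ᵇ S)
    ≡⟨ ∑-distrib-+ (count ∘ adjMinus G S) (λ v → count (λ u → (v , u) ∈ᵇ S)) ⟨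
  ∑[ v < n ] (count (adjMinus G S v) + count (λ u → (v , u) ∈ᵇ S))
    ≡⟨ sum-cong-≗ (λ v → trans (sym (∑-distrib-+ (𝟙 ∘ adjMinus G S v) (λ u → 𝟙 ((v , u) ∈ᵇ S))))
                                  (sum-cong-≗ (λ u → 𝟙-∧-not (adj G v u) _ (∈ᵇ⇒adj G S⊆E)))) ⟩
  ∑[ v < n ] count (adj G v)
    ≡⟨ sum-cong-≗ (degree≡count (adj G)) ⟨
  ∑[ v < n ] degree (adj G) v
    ∎
  where open ≡-Reasoning

-- numEdges G is length (edges G) by definition.
edges : ∀ {n} → Graph n → List (Edge n)
edges {n} G = filter (λ e → toℕ (proj₁ e) <? toℕ (proj₂ e))
  (filter (λ e → adj G (proj₁ e) (proj₂ e) Bool.≟ true) (cartesianProduct (allFin n) (allFin n)))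

edges-unique : ∀ {n} (G : Graph n) → Unique (edges G)
edges-unique {n} G = filter⁺ _ (filter⁺ _ (cartesianProduct⁺ (allFin⁺ n) (allFin⁺ n)))

edges⊆E : ∀ {n} (G : Graph n) → All (IsEdge G) (edges G)
edges⊆E {n} G = All.tabulate λ e∈edges →
  let e∈adj , ordered = ∈-filter⁻ (λ e → toℕ (proj₁ e) <? toℕ (proj₂ e)) e∈edges
  in ordered , proj₂ (∈-filter⁻ (λ e → adj G (proj₁ e) (proj₂ e) Bool.≟ true) {xs = cartesianProduct (allFin n) (allFin n)} e∈adj)

∈-edges⁺ : ∀ {n} (G : Graph n) {v u} → toℕ v < toℕ u → adj G v u ≡ true → (v , u) ∈ edges G
∈-edges⁺ G {v} {u} v<u v~u = ∈-filter⁺ _ (∈-filter⁺ _ (∈-cartesianProduct⁺ (∈-allFin v) (∈-allFin u)) v~u) v<u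

adj⇒∈edges : ∀ {n} (G : Graph n) {v u} → adj G v u ≡ true → (v , u) ∈ edges G ⊎ (u , v) ∈ edges G
adj⇒∈edges G {v} {u} v~u with <-cmp (toℕ v) (toℕ u)
... | tri< v<u _ _ = inj₁ (∈-edges⁺ G v<u v~u)
... | tri> _ _ u<v = inj₂ (∈-edges⁺ G u<v (trans (symm G u v) v~u))
... | tri≈ _ v≡u _ with refl ← toℕ-injective v≡u = contradiction (trans (sym v~u) (irrefl G v)) λ ()

adjMinus-edges : ∀ {n} (G : Graph n) v u → adjMinus G (edges G) v u ≡ false
adjMinus-edges G v u with adj G v u in v~u
... | false = refl
... | true  = cong not (from ∈ᵇ⇔ (adj⇒∈edges G v~u))

handshake : ∀ {n} (G : Graph n) → 2 * numEdges G ≡ ∑[ v < n ] degree (adj G) v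
handshake {n} G = begin
  2 * numEdges G
    ≡⟨ cong (_+ 2 * numEdges G) ∑-degree-empty ⟨
  ∑[ v < n ] degree (adjMinus G (edges G)) v + 2 * numEdges G
    ≡⟨ ∑-degree-adjMinus G (edges G) (edges⊆E G) (edges-unique G) ⟩
  ∑[ v < n ] degree (adj G) v
    ∎
  where
  open ≡-Reasoning
  ∑-degree-empty : ∑[ v < n ] degree (adjMinus G (edges G)) v ≡ 0
  ∑-degree-empty = ∑-zero λ v → trans (degree≡count (adjMinus G (edges G)) v) (count-none (adjMinus-edges G v))

handshake-adjMinus : ∀ {n} (G : Graph n) (S : List (Edge n)) → All (IsEdge G) S → Unique S →
  ∑[ v < n ] degree (adjMinus G S) v + 2 * length S ≡ 2 * numEdges G
handshake-adjMinus G S S⊆E unique = trans (∑-degree-adjMinus G S S⊆E unique) (sym (handshake G))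

≤0≡≟0 : ∀ x → ⌊ x ≤? 0 ⌋ ≡ ⌊ x ≟ℕ 0 ⌋
≤0≡≟0 zero    = refl
≤0≡≟0 (suc x) = refl

𝟙-≤?-suc : ∀ x m → 𝟙 ⌊ x ≤? suc m ⌋ ≡ 𝟙 ⌊ x ≟ℕ suc m ⌋ + 𝟙 ⌊ x ≤? m ⌋
𝟙-≤?-suc x m with <-cmp x (suc m)
... | tri< x<1+m x≢1+m _
  rewrite ⌊⌋-yes (x ≤? suc m) (<⇒≤ x<1+m) | ⌊⌋-no (x ≟ℕ suc m) x≢1+m | ⌊⌋-yes (x ≤? m) (s≤s⁻¹ x<1+m) = refl
... | tri≈ _ refl _
  rewrite ⌊⌋-yes (suc m ≤? suc m) ≤-refl | ⌊⌋-yes (suc m ≟ℕ suc m) refl | ⌊⌋-no (suc m ≤? m) (<-irrefl refl) = refl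
... | tri> _ x≢1+m 1+m<x
  rewrite ⌊⌋-no (x ≤? suc m) (<⇒≱ 1+m<x) | ⌊⌋-no (x ≟ℕ suc m) x≢1+m | ⌊⌋-no (x ≤? m) (<⇒≱ (<⇒≤ 1+m<x)) = refl

suc-∸ : ∀ k x → suc k ∸ x ≡ 𝟙 ⌊ x ≤? k ⌋ + (k ∸ x)
suc-∸ k x with x ≤? k
... | yes x≤k = +-∸-assoc 1 x≤k
... | no  x≰k = trans (m≤n⇒m∸n≡0 (≰⇒> x≰k)) (sym (m≤n⇒m∸n≡0 (<⇒≤ (≰⇒> x≰k))))

sumSquares : ℕ → ℕ
sumSquares zero    = 0
sumSquares (suc k) = suc k * suc k + sumSquares k

tetrahedral : ℕ → ℕ
tetrahedral zero    = 0
tetrahedral (suc k) = t k + tetrahedral k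

tetrahedral+sumSquares : ∀ k → tetrahedral k + sumSquares k ≡ k * t k
tetrahedral+sumSquares zero    = refl
tetrahedral+sumSquares (suc k) = begin
  (t k + tetrahedral k) + (suc k * suc k + sumSquares k)
    ≡⟨ regroup (t k) (tetrahedral k) (suc k * suc k) (sumSquares k) ⟩
  t k + suc k * suc k + (tetrahedral k + sumSquares k)
    ≡⟨ cong (t k + suc k * suc k +_) (tetrahedral+sumSquares k) ⟩
  t k + suc k * suc k + k * t k
    ≡⟨ expand k (t k) ⟩
  suc k * (suc k + t k)
    ∎
  where
  open ≡-Reasoning
  regroup : ∀ a b c d → (a + b) + (c + d) ≡ a + c + (b + d)
  regroup = solve-∀
  expand : ∀ k s → s + suc k * suc k + k * s ≡ suc k * (suc k + s)
  expand = solve-∀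

FibresBounded : ∀ {n} → (Fin n → ℕ) → Set
FibresBounded c = ∀ j → count (λ u → ⌊ c u ≟ℕ j ⌋) ≤ j

fibresBounded : ∀ {n} (c : Fin n → ℕ) → (∀ v → count (λ u → ⌊ c u ≟ℕ c v ⌋) ≤ c v) → FibresBounded c
fibresBounded c bound j with any? (λ v → c v ≟ℕ j)
... | yes (v , refl) = bound v
... | no  ∄v         = subst (_≤ j) (sym (count-none λ u → ⌊⌋-no (c u ≟ℕ j) (λ cu≡j → ∄v (u , cu≡j)))) z≤n

count-≤?≤t : ∀ {n} (c : Fin n → ℕ) → FibresBounded c →
  ∀ m → count (λ u → ⌊ c u ≤? m ⌋) ≤ t m
count-≤?≤t c fibres zero    = subst (_≤ 0) (sum-cong-≗ (λ u → cong 𝟙 (sym (≤0≡≟0 (c u))))) (fibres 0)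
count-≤?≤t {n} c fibres (suc m) = begin
  count (λ u → ⌊ c u ≤? suc m ⌋)
    ≡⟨ sum-cong-≗ (λ u → 𝟙-≤?-suc (c u) m) ⟩
  ∑[ u < n ] (𝟙 ⌊ c u ≟ℕ suc m ⌋ + 𝟙 ⌊ c u ≤? m ⌋)
    ≡⟨ ∑-distrib-+ (λ u → 𝟙 ⌊ c u ≟ℕ suc m ⌋) (λ u → 𝟙 ⌊ c u ≤? m ⌋) ⟩
  count (λ u → ⌊ c u ≟ℕ suc m ⌋) + count (λ u → ⌊ c u ≤? m ⌋)
    ≤⟨ +-mono-≤ (fibres (suc m)) (count-≤?≤t c fibres m) ⟩
  suc m + t m
    ∎
  where open ≤-Reasoning

∑∸≤tetrahedral : ∀ {n} (c : Fin n → ℕ) → FibresBounded c →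
  ∀ k → ∑[ v < n ] (k ∸ c v) ≤ tetrahedral k
∑∸≤tetrahedral c fibres zero    = ≤-reflexive (∑-zero (0∸n≡0 ∘ c))
∑∸≤tetrahedral {n} c fibres (suc k) = begin
  ∑[ v < n ] (suc k ∸ c v)
    ≡⟨ sum-cong-≗ (suc-∸ k ∘ c) ⟩
  ∑[ v < n ] (𝟙 ⌊ c v ≤? k ⌋ + (k ∸ c v))
    ≡⟨ ∑-distrib-+ (λ v → 𝟙 ⌊ c v ≤? k ⌋) (λ v → k ∸ c v) ⟩
  count (λ v → ⌊ c v ≤? k ⌋) + ∑[ v < n ] (k ∸ c v)
    ≤⟨ +-mono-≤ (count-≤?≤t c fibres k) (∑∸≤tetrahedral c fibres k) ⟩
  t k + tetrahedral k
    ∎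
  where open ≤-Reasoning

k*n≤sum+tetrahedral : ∀ {n} (c : Fin n → ℕ) → FibresBounded c →
  ∀ k → k * n ≤ sum c + tetrahedral k
k*n≤sum+tetrahedral {n} c fibres k = begin
  k * n                                ≡⟨ trans (*-comm k n) (sym (∑-const n k)) ⟩
  ∑[ v < n ] k                         ≤⟨ ∑-mono-≤ (λ v → m≤n+m∸n k (c v)) ⟩
  ∑[ v < n ] (c v + (k ∸ c v))         ≡⟨ ∑-distrib-+ c (λ v → k ∸ c v) ⟩
  sum c + ∑[ v < n ] (k ∸ c v)         ≤⟨ +-monoʳ-≤ (sum c) (∑∸≤tetrahedral c fibres k) ⟩
  sum c + tetrahedral k                ∎
  where open ≤-Reasoning

sumSquares≤sum : ∀ k (c : Fin (t k) → ℕ) → FibresBounded c → sumSquares k ≤ sum c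
sumSquares≤sum k c fibres = +-cancelˡ-≤ (tetrahedral k) _ _ (begin
  tetrahedral k + sumSquares k   ≡⟨ tetrahedral+sumSquares k ⟩
  k * t k                        ≤⟨ k*n≤sum+tetrahedral c fibres k ⟩
  sum c + tetrahedral k          ≡⟨ +-comm (sum c) (tetrahedral k) ⟩
  tetrahedral k + sum c          ∎)
  where open ≤-Reasoning

codegree : ∀ {n} → (Fin n → Fin n → Bool) → Fin n → ℕ
codegree {n} a v = n ∸ degree a v

count-same-codegree≤ : ∀ {n} {a : Fin n → Fin n → Bool} → LocallyIrregular a →
  ∀ v → count (λ u → ⌊ codegree a u ≟ℕ codegree a v ⌋) ≤ codegree a v
count-same-codegree≤ {n} {a} irregular v = m+n≤o⇒m≤o∸n (count same) (begin
  count same + degree a v               ≡⟨ cong (count same +_) (degree≡count a v) ⟩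
  count same + count (a v)              ≡⟨ ∑-distrib-+ (𝟙 ∘ same) (𝟙 ∘ a v) ⟨
  ∑[ u < n ] (𝟙 (same u) + 𝟙 (a v u))   ≤⟨ ∑-mono-≤ exclusive ⟩
  ∑[ u < n ] 1                          ≡⟨ ∑-const n 1 ⟩
  n * 1                                 ≡⟨ *-identityʳ n ⟩
  n                                     ∎)
  where
  open ≤-Reasoning
  same : Fin n → Bool
  same u = ⌊ codegree a u ≟ℕ codegree a v ⌋
  exclusive : ∀ u → 𝟙 (same u) + 𝟙 (a v u) ≤ 1
  exclusive u with a v u in v~u
  ... | false = subst (_≤ 1) (sym (+-identityʳ _)) (𝟙≤1 (same u))
  ... | true  = subst (λ b → 𝟙 b + 1 ≤ 1) (sym (⌊⌋-no (codegree a u ≟ℕ codegree a v) different)) ≤-refl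
    where
    different : codegree a u ≢ codegree a v
    different eq = irregular v u v~u (sym (∸-cancelˡ-≡ (degree≤ a u) (degree≤ a v) eq))

∑-degree+sumSquares≤ : ∀ k {a : Fin (t k) → Fin (t k) → Bool} → LocallyIrregular a →
  ∑[ v < t k ] degree a v + sumSquares k ≤ t k * t k
∑-degree+sumSquares≤ k {a} irregular = begin
  sum (degree a) + sumSquares k          ≤⟨ +-monoʳ-≤ (sum (degree a)) (sumSquares≤sum k (codegree a) fibres) ⟩
  sum (degree a) + sum (codegree a)      ≡⟨ ∑-distrib-+ (degree a) (codegree a) ⟨
  ∑[ v < n ] (degree a v + codegree a v) ≡⟨ sum-cong-≗ (λ v → m+[n∸m]≡n (degree≤ a v)) ⟩
  ∑[ v < n ] n                           ≡⟨ ∑-const n n ⟩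
  n * n                                  ∎
  where
  open ≤-Reasoning
  n = t k
  fibres : FibresBounded (codegree a)
  fibres = fibresBounded (codegree a) (count-same-codegree≤ irregular)

monochromatic : ∀ {n} → (Fin n → ℕ) → List (Edge n)
monochromatic {n} p = filter (λ e → p (proj₁ e) ≟ℕ p (proj₂ e)) (edges (complete n))

monochromatic⊆E : ∀ {n} (p : Fin n → ℕ) → All (IsEdge (complete n)) (monochromatic p)
monochromatic⊆E {n} p = All.tabulate (All.lookup (edges⊆E (complete n)) ∘ proj₁ ∘ ∈-filter⁻ _ {xs = edges (complete n)})

∈ᵇ-monochromatic : ∀ {n} (p : Fin n → ℕ) {v u} → v ≢ u → (v , u) ∈ᵇ monochromatic p ≡ ⌊ p u ≟ℕ p v ⌋
∈ᵇ-monochromatic {n} p {v} {u} v≢u with p u ≟ℕ p v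
... | yes pu≡pv = from ∈ᵇ⇔ (Sum.map (λ vu∈E → ∈-filter⁺ _ vu∈E (sym pu≡pv)) (λ uv∈E → ∈-filter⁺ _ uv∈E pu≡pv)
                               (adj⇒∈edges (complete n) (cong not (⌊⌋-no (v ≟ u) v≢u))))
... | no  pu≢pv with (v , u) ∈ᵇ monochromatic p in vu∈S
...   | false = refl
...   | true  = contradiction (to ∈ᵇ⇔ vu∈S) λ where
                  (inj₁ vu∈S) → pu≢pv (sym (proj₂ (∈-filter⁻ _ {xs = edges (complete n)} vu∈S)))
                  (inj₂ uv∈S) → pu≢pv (proj₂ (∈-filter⁻ _ {xs = edges (complete n)} uv∈S))

adjMinus-monochromatic : ∀ {n} (p : Fin n → ℕ) v u → adjMinus (complete n) (monochromatic p) v u ≡ not ⌊ p u ≟ℕ p v ⌋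
adjMinus-monochromatic p v u with v ≟ u
... | yes refl rewrite ⌊⌋-yes (p v ≟ℕ p v) refl = refl
... | no  v≢u  = cong not (∈ᵇ-monochromatic p v≢u)

degree-monochromatic : ∀ {n} (p : Fin n → ℕ) v →
  degree (adjMinus (complete n) (monochromatic p)) v + count (λ u → ⌊ p u ≟ℕ p v ⌋) ≡ n
degree-monochromatic {n} p v = begin
  degree a v + count same-colour
    ≡⟨ cong (_+ count same-colour) (degree≡count a v) ⟩
  count (a v) + count same-colour
    ≡⟨ cong (_+ count same-colour) (sum-cong-≗ (cong 𝟙 ∘ adjMinus-monochromatic p v)) ⟩
  count (not ∘ same-colour) + count same-colour
    ≡⟨ count-not same-colour ⟩
  n ∎
  where
  open ≡-Reasoning
  a = adjMinus (complete n) (monochromatic p)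
  same-colour : Fin n → Bool
  same-colour u = ⌊ p u ≟ℕ p v ⌋

-- The first k + 1 vertices of Fin (t (k + 1)) form the block labelled k, so block j has j + 1
-- vertices.
block : ∀ k → Fin (t k) → ℕ
block (suc k) v = [ const k , block k ]′ (splitAt (suc k) v)

block-↑ˡ : ∀ k (i : Fin (suc k)) → block (suc k) (i ↑ˡ t k) ≡ k
block-↑ˡ k i rewrite splitAt-↑ˡ (suc k) i (t k) = refl

block-↑ʳ : ∀ k (v : Fin (t k)) → block (suc k) (suc k ↑ʳ v) ≡ block k v
block-↑ʳ k v rewrite splitAt-↑ʳ (suc k) (t k) v = refl

block< : ∀ k v → block k v < k
block< (suc k) v with splitAt (suc k) v
... | inj₁ _ = ≤-refl
... | inj₂ w = m<n⇒m<1+n (block< k w)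

count-block-suc : ∀ k j → count (λ u → ⌊ block (suc k) u ≟ℕ j ⌋) ≡ suc k * 𝟙 ⌊ k ≟ℕ j ⌋ + count (λ v → ⌊ block k v ≟ℕ j ⌋)
count-block-suc k j = trans (∑-↑ (suc k) (λ u → 𝟙 ⌊ block (suc k) u ≟ℕ j ⌋)) (cong₂ _+_
  (trans (sum-cong-≗ (λ i → cong (λ b → 𝟙 ⌊ b ≟ℕ j ⌋) (block-↑ˡ k i))) (∑-const (suc k) _))
  (sum-cong-≗ (λ v → cong (λ b → 𝟙 ⌊ b ≟ℕ j ⌋) (block-↑ʳ k v))))

count-block : ∀ k j → j < k → count (λ u → ⌊ block k u ≟ℕ j ⌋) ≡ suc j
count-block (suc k) j j<1+k rewrite count-block-suc k j with k ≟ℕ j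
... | yes refl = trans (cong₂ _+_ (*-identityʳ (suc k)) (count-none λ v → ⌊⌋-no (block k v ≟ℕ k) (<⇒≢ (block< k v)))) (+-identityʳ (suc k))
... | no  k≢j  = trans (cong (_+ count (λ v → ⌊ block k v ≟ℕ j ⌋)) (*-zeroʳ (suc k))) (count-block k j (≤∧≢⇒< (s≤s⁻¹ j<1+k) (k≢j ∘ sym)))

∑-suc-block : ∀ k → ∑[ v < t k ] suc (block k v) ≡ sumSquares k
∑-suc-block zero    = refl
∑-suc-block (suc k) = trans (∑-↑ (suc k) (suc ∘ block (suc k))) (cong₂ _+_
  (trans (sum-cong-≗ (cong suc ∘ block-↑ˡ k)) (∑-const (suc k) (suc k)))
  (trans (sum-cong-≗ (cong suc ∘ block-↑ʳ k)) (∑-suc-block k)))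

blocks : ∀ k → List (Edge (t k))
blocks k = monochromatic (block k)

degree-blocks : ∀ k v → degree (adjMinus (complete (t k)) (blocks k)) v + suc (block k v) ≡ t k
degree-blocks k v = trans (cong (degree (adjMinus (complete (t k)) (blocks k)) v +_) (sym (count-block k (block k v) (block< k v))))
                          (degree-monochromatic (block k) v)

blocks-irregulator : ∀ k → IsEdgeIrregulator (complete (t k)) (blocks k)
blocks-irregulator k = monochromatic⊆E (block k) , filter⁺ _ (edges-unique (complete (t k))) , irregular
  where
  d = degree (adjMinus (complete (t k)) (blocks k))
  irregular : LocallyIrregular (adjMinus (complete (t k)) (blocks k))
  irregular u v u~v du≡dv = contradiction (trans (sym u~v) (trans (adjMinus-monochromatic (block k) u v) not-same)) λ ()
    where
    same-block : block k u ≡ block k v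
    same-block = suc-injective (+-cancelˡ-≡ (d u) _ _
      (trans (degree-blocks k u) (sym (trans (cong (_+ suc (block k v)) du≡dv) (degree-blocks k v)))))
    not-same : not ⌊ block k v ≟ℕ block k u ⌋ ≡ false
    not-same = cong not (⌊⌋-yes (block k v ≟ℕ block k u) (sym same-block))

∑-degree-blocks : ∀ k → ∑[ v < t k ] degree (adjMinus (complete (t k)) (blocks k)) v + sumSquares k ≡ t k * t k
∑-degree-blocks k = begin
  sum d + sumSquares k                    ≡⟨ cong (sum d +_) (∑-suc-block k) ⟨
  sum d + ∑[ v < t k ] suc (block k v)    ≡⟨ ∑-distrib-+ d (suc ∘ block k) ⟨
  ∑[ v < t k ] (d v + suc (block k v))    ≡⟨ sum-cong-≗ (degree-blocks k) ⟩
  ∑[ v < t k ] t k                        ≡⟨ ∑-const (t k) (t k) ⟩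
  t k * t k                               ∎
  where
  open ≡-Reasoning
  d = degree (adjMinus (complete (t k)) (blocks k))

multipartiteEdges : ℕ → ℕ
multipartiteEdges zero    = 0
multipartiteEdges (suc k) = suc k * t k + multipartiteEdges k

2*t[k]≡k*[1+k] : ∀ k → 2 * t k ≡ k * suc k
2*t[k]≡k*[1+k] zero    = refl
2*t[k]≡k*[1+k] (suc k) = begin
  2 * (suc k + t k)       ≡⟨ *-distribˡ-+ 2 (suc k) (t k) ⟩
  2 * suc k + 2 * t k     ≡⟨ cong (2 * suc k +_) (2*t[k]≡k*[1+k] k) ⟩
  2 * suc k + k * suc k   ≡⟨ *-distribʳ-+ (suc k) 2 k ⟨
  (2 + k) * suc k         ≡⟨ *-comm (2 + k) (suc k) ⟩
  suc k * suc (suc k)     ∎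
  where open ≡-Reasoning

2*multipartiteEdges+sumSquares : ∀ k → 2 * multipartiteEdges k + sumSquares k ≡ t k * t k
2*multipartiteEdges+sumSquares zero    = refl
2*multipartiteEdges+sumSquares (suc k) = begin
  2 * (suc k * t k + multipartiteEdges k) + (suc k * suc k + sumSquares k)
    ≡⟨ regroup (suc k) (t k) (multipartiteEdges k) (sumSquares k) ⟩
  2 * suc k * t k + suc k * suc k + (2 * multipartiteEdges k + sumSquares k)
    ≡⟨ cong (2 * suc k * t k + suc k * suc k +_) (2*multipartiteEdges+sumSquares k) ⟩
  2 * suc k * t k + suc k * suc k + t k * t k
    ≡⟨ square (suc k) (t k) ⟩
  (suc k + t k) * (suc k + t k)
    ∎
  where
  open ≡-Reasoning
  regroup : ∀ a s e q → 2 * (a * s + e) + (a * a + q) ≡ 2 * a * s + a * a + (2 * e + q)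
  regroup = solve-∀
  square : ∀ a s → 2 * a * s + a * a + s * s ≡ (a + s) * (a + s)
  square = solve-∀

multipartiteEdges*24 : ∀ j → multipartiteEdges (suc j) * 24 ≡ suc j * (suc j + 1) * j * (3 * suc j + 2)
multipartiteEdges*24 zero    = refl
multipartiteEdges*24 (suc j) = begin
  (suc (suc j) * t (suc j) + multipartiteEdges (suc j)) * 24
    ≡⟨ distribute (suc (suc j)) (t (suc j)) (multipartiteEdges (suc j)) ⟩
  12 * suc (suc j) * (2 * t (suc j)) + multipartiteEdges (suc j) * 24
    ≡⟨ cong₂ (λ s e → 12 * suc (suc j) * s + e) (2*t[k]≡k*[1+k] (suc j)) (multipartiteEdges*24 j) ⟩
  12 * suc (suc j) * (suc j * suc (suc j)) + suc j * (suc j + 1) * j * (3 * suc j + 2)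
    ≡⟨ closed-form j ⟩
  suc (suc j) * (suc (suc j) + 1) * suc j * (3 * suc (suc j) + 2)
    ∎
  where
  open ≡-Reasoning
  distribute : ∀ a s e → (a * s + e) * 24 ≡ 12 * a * (2 * s) + e * 24
  distribute = solve-∀
  closed-form : ∀ j → 12 * suc (suc j) * (suc j * suc (suc j)) + suc j * (suc j + 1) * j * (3 * suc j + 2)
                    ≡ suc (suc j) * (suc (suc j) + 1) * suc j * (3 * suc (suc j) + 2)
  closed-form = solve-∀

multipartiteEdges-closed : ∀ k → k * (k + 1) * (k ∸ 1) * (3 * k + 2) / 24 ≡ multipartiteEdges k
multipartiteEdges-closed zero    = refl
multipartiteEdges-closed (suc j) = trans (cong (_/ 24) (sym (multipartiteEdges*24 j))) (m*n/n≡m (multipartiteEdges (suc j)) 24)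

IeIs-blocks : ∀ k → IeIs (complete (t k)) (length (blocks k))
IeIs-blocks k = (blocks k , blocks-irregulator k , refl) , minimal
  where
  S₀⊆E = proj₁ (blocks-irregulator k)
  unique₀ = proj₁ (proj₂ (blocks-irregulator k))
  K = complete (t k)
  d₀ = degree (adjMinus K (blocks k))
  minimal : ∀ S → IsEdgeIrregulator K S → length (blocks k) ≤ length S
  minimal S (S⊆E , unique , irregular) = *-cancelˡ-≤ 2 (+-cancelˡ-≤ (sum d₀) _ _ (begin
    sum d₀ + 2 * length (blocks k)                            ≡⟨ handshake-adjMinus K (blocks k) S₀⊆E unique₀ ⟩
    2 * numEdges K                                            ≡⟨ handshake-adjMinus K S S⊆E unique ⟨
    ∑[ v < t k ] degree (adjMinus K S) v + 2 * length S       ≤⟨ +-monoˡ-≤ (2 * length S) ∑d≤∑d₀ ⟩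
    sum d₀ + 2 * length S                                     ∎))
    where
    open ≤-Reasoning
    ∑d≤∑d₀ : ∑[ v < t k ] degree (adjMinus K S) v ≤ sum d₀
    ∑d≤∑d₀ = +-cancelʳ-≤ (sumSquares k) _ _
      (≤-trans (∑-degree+sumSquares≤ k irregular) (≤-reflexive (sym (∑-degree-blocks k))))

length-blocks : ∀ k → length (blocks k) + multipartiteEdges k ≡ numEdges (complete (t k))
length-blocks k = *-cancelˡ-≡ _ _ 2 (begin
  2 * (length (blocks k) + multipartiteEdges k)          ≡⟨ *-distribˡ-+ 2 (length (blocks k)) (multipartiteEdges k) ⟩
  2 * length (blocks k) + 2 * multipartiteEdges k        ≡⟨ cong (2 * length (blocks k) +_) 2E≡∑d₀ ⟩
  2 * length (blocks k) + sum d₀                         ≡⟨ +-comm (2 * length (blocks k)) (sum d₀) ⟩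
  sum d₀ + 2 * length (blocks k)                         ≡⟨ handshake-adjMinus K (blocks k) S⊆E unique ⟩
  2 * numEdges K                                         ∎)
  where
  open ≡-Reasoning
  K = complete (t k)
  d₀ = degree (adjMinus K (blocks k))
  S⊆E = proj₁ (blocks-irregulator k)
  unique = proj₁ (proj₂ (blocks-irregulator k))
  2E≡∑d₀ : 2 * multipartiteEdges k ≡ sum d₀
  2E≡∑d₀ = +-cancelʳ-≡ (sumSquares k) _ _ (trans (2*multipartiteEdges+sumSquares k) (sym (∑-degree-blocks k)))

theorem10 : ∀ (k : ℕ) → k ≥ 1 →
    IeIs (complete (t k)) (numEdges (complete (t k)) ∸ (k * (k + 1) * (k ∸ 1) * (3 * k + 2)) / 24)
theorem10 k _ = subst (IeIs (complete (t k))) length≡ (IeIs-blocks k)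
  where
  length≡ : length (blocks k) ≡ numEdges (complete (t k)) ∸ (k * (k + 1) * (k ∸ 1) * (3 * k + 2)) / 24
  length≡ = begin
    length (blocks k)                                             ≡⟨ m+n∸n≡m (length (blocks k)) (multipartiteEdges k) ⟨
    length (blocks k) + multipartiteEdges k ∸ multipartiteEdges k ≡⟨ cong₂ _∸_ (length-blocks k) (sym (multipartiteEdges-closed k)) ⟩
    numEdges (complete (t k)) ∸ (k * (k + 1) * (k ∸ 1) * (3 * k + 2)) / 24 ∎
    where open ≡-Reasoning
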